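{- Let $H$ be a $c$-colored digraph that has an up-color kernel, let $w\in V(H)$, and let $G$ be obtained from $H$ by adding a new vertex $v$ (with color $c(v)$) and the arc $(w,v)$. Then $G$ has an up-color kernel if and only if either $c(v)>c(w)$ and $H\setminus\{w\}=G\setminus\{v,w\}$ has an up-color kernel, or $0<c(v)\le c(w)$ and $H$ has an up-color kernel which does not contain $w$.
   Context: A $c$-colored digraph has a function $c:V\to\{0,1,2,\ldots\}$. A set $N$ of vertices is up-color absorbent if every vertex $x\notin N$ has an out-neighbor $y\in N$ with $c(x)<c(y)$, and no vertex of $N$ has color $0$. An up-color kernel is an independent up-color absorbent set. -}

module Defs where

open import Data.Nat using (ℕ; zero; suc; _<_; _≤_)
open import Data.Bool using (Bool; true; false)
open import Data.Fin using (Fin; zero; suc; punchIn)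
open import Data.Fin.Properties using (_≟_)
open import Data.Fin.Subset using (Subset; _∈_; _∉_)
open import Data.Product using (Σ; _×_; ∃)
open import Relation.Binary.PropositionalEquality using (_≡_)
open import Relation.Nullary using (¬_; does)

record ColoredDigraph (n : ℕ) : Set where
  field
    arc   : Fin n → Fin n → Bool
    color : Fin n → ℕ

open ColoredDigraph public

module _ {n : ℕ} (D : ColoredDigraph n) where

  Independent : Subset n → Set
  Independent N = ∀ x y → x ∈ N → y ∈ N → arc D x y ≡ false

  UpColorAbsorbent : Subset n → Set
  UpColorAbsorbent N =
    (∀ x → x ∉ N → ∃ λ y → y ∈ N × arc D x y ≡ true × color D x < color D y)
    × (∀ x → x ∈ N → ¬ (color D x ≡ 0))

  IsUpColorKernel : Subset n → Set
  IsUpColorKernel N = Independent N × UpColorAbsorbent N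

  HasUpColorKernel : Set
  HasUpColorKernel = ∃ λ N → IsUpColorKernel N

-- G = H plus a new vertex v (represented by zero, old vertices by suc)
-- with color cv and the single new arc (w , v).
addPendant : ∀ {n} → ColoredDigraph n → Fin n → ℕ → ColoredDigraph (suc n)
arc (addPendant H w cv) zero    _       = false
arc (addPendant H w cv) (suc x) zero    = does (x ≟ w)
arc (addPendant H w cv) (suc x) (suc y) = arc H x y
color (addPendant H w cv) zero    = cv
color (addPendant H w cv) (suc x) = color H x

deleteVertex : ∀ {m} → ColoredDigraph (suc m) → Fin (suc m) → ColoredDigraph m
arc (deleteVertex H w) x y = arc H (punchIn w x) (punchIn w y)
color (deleteVertex H w) x = color H (punchIn w x)

{-# OPTIONS --safe #-}
-- The new vertex v is a sink, so it lies in every up-color kernel K of G;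
-- then w ∉ K because of the arc (w , v), and the only role v plays for
-- the rest of G is to absorb w, which it does exactly when c(w) < c(v).
-- So K ∖ {v} is a set of H avoiding w that satisfies every kernel condition
-- except possibly absorbing w: if c(w) < c(v) this is precisely an
-- up-color kernel of H ∖ {w}, and otherwise w must be absorbed inside H,
-- making K ∖ {v} an up-color kernel of H. Both steps reverse.
module Submission where

open import Defs
open import Data.Nat using (ℕ; zero; suc; _<_; _≤_; z≤n)
open import Data.Nat.Properties using (_<?_; ≮⇒≥; ≤-<-trans; n≢0⇒n>0; n>0⇒n≢0)
open import Data.Bool using (true; false)
open import Data.Fin using (Fin; zero; suc; punchIn; punchOut)
open import Data.Fin.Properties using (_≟_; punchIn-punchOut; punchOut-punchIn; punchInᵢ≢i)
open import Data.Fin.Subset using (Subset; _∈_; _∉_; outside)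
open import Data.Fin.Subset.Properties using (_∈?_)
open import Data.Vec using (Vec; _∷_; lookup; insertAt; removeAt; here; there)
open import Data.Vec.Properties using ([]=⇒lookup; lookup⇒[]=; removeAt-punchOut; insertAt-lookup; removeAt-insertAt)
open import Data.Product using (_×_; ∃; _,_; proj₂)
open import Data.Sum using (_⊎_; inj₁; inj₂; fromInj₂; map₁)
open import Function using (_∘_; _⇔_; mk⇔; Equivalence)
open import Relation.Nullary using (¬_; yes; no; contradiction)
open import Relation.Nullary.Decidable using (dec-true; dec-false)
open import Relation.Binary.PropositionalEquality using (_≡_; _≢_; refl; sym; trans; subst; cong; ≢-sym; module ≡-Reasoning)

open Equivalence

data PunchedIn {n : ℕ} (i : Fin (suc n)) : Fin (suc n) → Set where
  punchedIn : ∀ j → PunchedIn i (punchIn i j)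

punchedIn-view : ∀ {n} {i j : Fin (suc n)} → i ≢ j → PunchedIn i j
punchedIn-view i≢j = subst (PunchedIn _) (punchIn-punchOut i≢j) (punchedIn (punchOut i≢j))

lookup-removeAt-punchIn : ∀ {a} {A : Set a} {n} (xs : Vec A (suc n)) i j →
                          lookup (removeAt xs i) j ≡ lookup xs (punchIn i j)
lookup-removeAt-punchIn xs i j = begin
  lookup (removeAt xs i) j                                    ≡⟨ cong (lookup (removeAt xs i)) (sym (punchOut-punchIn i)) ⟩
  lookup (removeAt xs i) (punchOut (punchInᵢ≢i i j ∘ sym))    ≡⟨ removeAt-punchOut xs _ ⟩
  lookup xs (punchIn i j)                                     ∎
  where open ≡-Reasoning

module _ {n : ℕ} where

  ∈-removeAt⇔ : ∀ {p : Subset (suc n)} {i j} → j ∈ removeAt p i ⇔ punchIn i j ∈ p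
  ∈-removeAt⇔ {p} {i} {j} = mk⇔
    (λ j∈ → lookup⇒[]= _ p (trans (sym (lookup-removeAt-punchIn p i j)) ([]=⇒lookup j∈)))
    (λ ij∈ → lookup⇒[]= j _ (trans (lookup-removeAt-punchIn p i j) ([]=⇒lookup ij∈)))

  insertAt-outside-∉ : ∀ (p : Subset n) i → i ∉ insertAt p i outside
  insertAt-outside-∉ p i i∈ with trans (sym (insertAt-lookup p i outside)) ([]=⇒lookup i∈)
  ... | ()

  punchedIn-∈ : ∀ {p : Subset (suc n)} {i x} → i ∉ p → x ∈ p → PunchedIn i x
  punchedIn-∈ i∉p x∈p = punchedIn-view λ { refl → i∉p x∈p }

module _ {n : ℕ} (D : ColoredDigraph n) where

  UpColorAbsorbs : Subset n → Fin n → Set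
  UpColorAbsorbs N x = ∃ λ y → y ∈ N × arc D x y ≡ true × color D x < color D y

  IsUpColorKernelExcept : Fin n → Subset n → Set
  IsUpColorKernelExcept w N =
    Independent D N
    × (∀ x → x ≢ w → x ∉ N → UpColorAbsorbs N x)
    × (∀ x → x ∈ N → ¬ (color D x ≡ 0))

  sink∈upColorAbsorbent : ∀ {N x} → (∀ y → arc D x y ≡ false) → UpColorAbsorbent D N → x ∈ N
  sink∈upColorAbsorbent {N} {x} sink (absorb , _) with x ∈? N
  ... | yes x∈N = x∈N
  ... | no x∉N with absorb x x∉N
  ...   | y , _ , arc≡true , _ with trans (sym arc≡true) (sink y)
  ...     | ()

  isUpColorKernel⇔except : ∀ {N w} → w ∉ N →
    IsUpColorKernel D N ⇔ (IsUpColorKernelExcept w N × UpColorAbsorbs N w)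
  isUpColorKernel⇔except {N} {w} w∉N = mk⇔
    (λ (ind , absorb , nz) → (ind , (λ x _ → absorb x) , nz) , absorb w w∉N)
    (λ ((ind , absorb , nz) , absorbW) → ind , absorbAll absorb absorbW , nz)
    where
    absorbAll : (∀ x → x ≢ w → x ∉ N → UpColorAbsorbs N x) → UpColorAbsorbs N w →
                ∀ x → x ∉ N → UpColorAbsorbs N x
    absorbAll absorb absorbW x x∉N with x ≟ w
    ... | yes refl = absorbW
    ... | no x≢w   = absorb x x≢w x∉N

module _ {m : ℕ} (H : ColoredDigraph (suc m)) (w : Fin (suc m)) where

  isUpColorKernel-deleteVertex⇔ : ∀ {N} → w ∉ N →
    IsUpColorKernel (deleteVertex H w) (removeAt N w) ⇔ IsUpColorKernelExcept H w N
  isUpColorKernel-deleteVertex⇔ {N} w∉N = mk⇔ lift restrict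
    where
    lift : IsUpColorKernel (deleteVertex H w) (removeAt N w) → IsUpColorKernelExcept H w N
    lift (ind , absorb , nz) = ind′ , absorb′ , nz′
      where
      ind′ : Independent H N
      ind′ x y x∈N y∈N with punchedIn-∈ w∉N x∈N | punchedIn-∈ w∉N y∈N
      ... | punchedIn j | punchedIn k = ind j k (from ∈-removeAt⇔ x∈N) (from ∈-removeAt⇔ y∈N)
      absorb′ : ∀ x → x ≢ w → x ∉ N → UpColorAbsorbs H N x
      absorb′ x x≢w x∉N with punchedIn-view (≢-sym x≢w)
      ... | punchedIn j with absorb j (x∉N ∘ to ∈-removeAt⇔)
      ...   | k , k∈ , arc≡true , c< = punchIn w k , to ∈-removeAt⇔ k∈ , arc≡true , c<
      nz′ : ∀ x → x ∈ N → ¬ (color H x ≡ 0)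
      nz′ x x∈N with punchedIn-∈ w∉N x∈N
      ... | punchedIn j = nz j (from ∈-removeAt⇔ x∈N)
    restrict : IsUpColorKernelExcept H w N → IsUpColorKernel (deleteVertex H w) (removeAt N w)
    restrict (ind , absorb , nz) = ind′ , absorb′ , nz′
      where
      ind′ : Independent (deleteVertex H w) (removeAt N w)
      ind′ j k j∈ k∈ = ind (punchIn w j) (punchIn w k) (to ∈-removeAt⇔ j∈) (to ∈-removeAt⇔ k∈)
      absorb′ : ∀ j → j ∉ removeAt N w → UpColorAbsorbs (deleteVertex H w) (removeAt N w) j
      absorb′ j j∉ with absorb (punchIn w j) (punchInᵢ≢i w j) (j∉ ∘ from ∈-removeAt⇔)
      ... | y , y∈N , arc≡true , c< with punchedIn-∈ w∉N y∈N
      ...   | punchedIn k = k , from ∈-removeAt⇔ y∈N , arc≡true , c<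
      nz′ : ∀ j → j ∈ removeAt N w → ¬ (color H (punchIn w j) ≡ 0)
      nz′ j j∈ = nz (punchIn w j) (to ∈-removeAt⇔ j∈)

module _ {n : ℕ} (H : ColoredDigraph n) (w : Fin n) (cv : ℕ) where

  private
    G : ColoredDigraph (suc n)
    G = addPendant H w cv

  addPendant-arc : arc G (suc w) zero ≡ true
  addPendant-arc = dec-true (w ≟ w) refl

  addPendant-arc⁻ : ∀ {x} → arc G (suc x) zero ≡ true → x ≡ w
  addPendant-arc⁻ {x} arc≡true with x ≟ w
  addPendant-arc⁻ _  | yes x≡w = x≡w
  addPendant-arc⁻ () | no _

  upColorAbsorbs-addPendant⇔ : ∀ {N x} →
    UpColorAbsorbs G (true ∷ N) (suc x) ⇔ ((x ≡ w × color H x < cv) ⊎ UpColorAbsorbs H N x)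
  upColorAbsorbs-addPendant⇔ {x = x} = mk⇔
    (λ { (zero , _ , arc≡true , c<) → inj₁ (addPendant-arc⁻ arc≡true , c<)
       ; (suc y , there y∈N , arc≡true , c<) → inj₂ (y , y∈N , arc≡true , c<) })
    (λ { (inj₁ (refl , c<)) → zero , here , addPendant-arc , c<
       ; (inj₂ (y , y∈N , arc≡true , c<)) → suc y , there y∈N , arc≡true , c< })

  isUpColorKernel-addPendant⇔ : ∀ {N} →
    IsUpColorKernel G (true ∷ N)
    ⇔ (0 < cv × w ∉ N × IsUpColorKernelExcept H w N × (color H w < cv ⊎ UpColorAbsorbs H N w))
  isUpColorKernel-addPendant⇔ {N} = mk⇔ restrict extend
    where
    restrict : IsUpColorKernel G (true ∷ N) →
      0 < cv × w ∉ N × IsUpColorKernelExcept H w N × (color H w < cv ⊎ UpColorAbsorbs H N w)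
    restrict (ind , absorb , nz) =
      n≢0⇒n>0 (nz zero here) , w∉N , (ind′ , absorb′ , λ x → nz (suc x) ∘ there) , absorbW
      where
      w∉N : w ∉ N
      w∉N w∈N with trans (sym addPendant-arc) (ind (suc w) zero (there w∈N) here)
      ... | ()
      ind′ : Independent H N
      ind′ x y x∈N y∈N = ind (suc x) (suc y) (there x∈N) (there y∈N)
      absorbedInG : ∀ x → x ∉ N → (x ≡ w × color H x < cv) ⊎ UpColorAbsorbs H N x
      absorbedInG x x∉N = to upColorAbsorbs-addPendant⇔ (absorb (suc x) λ { (there x∈N) → x∉N x∈N })
      absorb′ : ∀ x → x ≢ w → x ∉ N → UpColorAbsorbs H N x
      absorb′ x x≢w x∉N = fromInj₂ (λ (x≡w , _) → contradiction x≡w x≢w) (absorbedInG x x∉N)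
      absorbW : color H w < cv ⊎ UpColorAbsorbs H N w
      absorbW = map₁ proj₂ (absorbedInG w w∉N)
    extend : 0 < cv × w ∉ N × IsUpColorKernelExcept H w N × (color H w < cv ⊎ UpColorAbsorbs H N w) →
      IsUpColorKernel G (true ∷ N)
    extend (0<cv , w∉N , (ind , absorb , nz) , absorbW) = ind′ , absorb′ , nz′
      where
      ind′ : Independent G (true ∷ N)
      ind′ zero    _       _            _            = refl
      ind′ (suc x) zero    (there x∈N)  _            = dec-false (x ≟ w) λ { refl → w∉N x∈N }
      ind′ (suc x) (suc y) (there x∈N)  (there y∈N)  = ind x y x∈N y∈N
      absorb′ : ∀ x → x ∉ true ∷ N → UpColorAbsorbs G (true ∷ N) x
      absorb′ zero    v∉ = contradiction here v∉
      absorb′ (suc x) x∉ with x ≟ w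
      ... | yes refl = from upColorAbsorbs-addPendant⇔ (map₁ (refl ,_) absorbW)
      ... | no x≢w   = from upColorAbsorbs-addPendant⇔ (inj₂ (absorb x x≢w (x∉ ∘ there)))
      nz′ : ∀ x → x ∈ true ∷ N → ¬ (color G x ≡ 0)
      nz′ zero    _           = n>0⇒n≢0 0<cv
      nz′ (suc x) (there x∈N) = nz x x∈N

mainTheorem18 : ∀ {m} (H : ColoredDigraph (suc m)) (w : Fin (suc m)) (cv : ℕ)
    → HasUpColorKernel H
    → HasUpColorKernel (addPendant H w cv)
      ⇔ ((color H w < cv × HasUpColorKernel (deleteVertex H w))
         ⊎ (0 < cv × cv ≤ color H w
            × ∃ λ N → IsUpColorKernel H N × w ∉ N))
mainTheorem18 H w cv _ = mk⇔ forward backward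
  where
  forward : HasUpColorKernel (addPendant H w cv) →
    (color H w < cv × HasUpColorKernel (deleteVertex H w))
    ⊎ (0 < cv × cv ≤ color H w × ∃ λ N → IsUpColorKernel H N × w ∉ N)
  forward (K , κ) with sink∈upColorAbsorbent (addPendant H w cv) {K} {zero} (λ _ → refl) (proj₂ κ)
  forward (true ∷ N , κ) | here with to (isUpColorKernel-addPendant⇔ H w cv) κ
  ... | 0<cv , w∉N , except , absorbW with color H w <? cv
  ...   | yes c<cv = inj₁ (c<cv , removeAt N w , from (isUpColorKernel-deleteVertex⇔ H w w∉N) except)
  ...   | no c≮cv  = inj₂ (0<cv , ≮⇒≥ c≮cv , N , from (isUpColorKernel⇔except H w∉N) (except , absorbW′) , w∉N)
    where absorbW′ = fromInj₂ (λ c<cv → contradiction c<cv c≮cv) absorbW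
  backward : (color H w < cv × HasUpColorKernel (deleteVertex H w))
    ⊎ (0 < cv × cv ≤ color H w × ∃ λ N → IsUpColorKernel H N × w ∉ N) →
    HasUpColorKernel (addPendant H w cv)
  backward (inj₁ (c<cv , N′ , κ′)) =
    true ∷ N , from (isUpColorKernel-addPendant⇔ H w cv) (≤-<-trans z≤n c<cv , w∉N , except , inj₁ c<cv)
    where
    N = insertAt N′ w outside
    w∉N = insertAt-outside-∉ N′ w
    except = to (isUpColorKernel-deleteVertex⇔ H w w∉N)
                (subst (IsUpColorKernel (deleteVertex H w)) (sym (removeAt-insertAt N′ w outside)) κ′)
  backward (inj₂ (0<cv , _ , N , κ , w∉N)) with to (isUpColorKernel⇔except H w∉N) κ
  ... | except , absorbW = true ∷ N , from (isUpColorKernel-addPendant⇔ H w cv) (0<cv , w∉N , except , inj₂ absorbW)
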